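{- Let $G$ be a finite group, $N$ a normal subgroup of $G$, and $H$ a subgroup of $G$ containing $N$. Then: (a) if $H$ is a perfect code of $G$, then $H/N$ is a perfect code of $G/N$; (b) if $N$ is a perfect code of $G$ and $H/N$ is a perfect code of $G/N$, then $H$ is a perfect code of $G$.
   Context: All groups are finite. For a group $G$, a connection set is a subset $S\subseteq G\setminus\{1\}$ with $S^{ -1}=S$; the Cayley graph $\mathrm{Cay}(G,S)$ has vertex set $G$, with $x,y$ adjacent iff $yx^{ -1}\in S$. A perfect code in a graph $\Gamma$ is a subset $C$ of vertices such that every vertex of $\Gamma$ is at distance at most $1$ from exactly one vertex of $C$. A subgroup $H$ of a group $G$ is called a perfect code of $G$ if there exists a connection set $S$ of $G$ such that $H$ is a perfect code in $\mathrm{Cay}(G,S)$. -}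

module Defs where

open import Level using (Level; _⊔_) renaming (suc to lsuc)
open import Algebra.Bundles using (Group)
open import Algebra.Structures using (IsGroup; IsMonoid; IsSemigroup; IsMagma)
open import Data.List using (List)
open import Data.List.Relation.Unary.Any using (Any)
import Data.List.Relation.Unary.Any as Any
open import Data.Product using (Σ; ∃; _×_; _,_; proj₁; proj₂)
open import Data.Sum using (_⊎_)
open import Relation.Nullary using (¬_; Dec)
open import Relation.Binary using (Decidable; IsEquivalence)
import Algebra.Properties.Group as GP
import Relation.Binary.Reasoning.Setoid as SetoidR

record FiniteGroup (c ℓ : Level) : Set (lsuc (c ⊔ ℓ)) where
  field
    group    : Group c ℓ
  open Group group public
  field
    _≟_      : Decidable _≈_
    elements : List Carrier
    complete : ∀ x → Any (x ≈_) elements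

module _ {c ℓ : Level} (G : Group c ℓ) where
  open Group G

  record Subset : Set (c ⊔ lsuc ℓ) where
    field
      mem  : Carrier → Set ℓ
      resp : ∀ {x y} → x ≈ y → mem x → mem y
      dec  : ∀ x → Dec (mem x)

  record Subgroup : Set (c ⊔ lsuc ℓ) where
    field
      subset : Subset
    open Subset subset public
    field
      ε-mem  : mem ε
      ∙-mem  : ∀ {x y} → mem x → mem y → mem (x ∙ y)
      ⁻¹-mem : ∀ {x} → mem x → mem (x ⁻¹)

  IsNormal : Subgroup → Set (c ⊔ ℓ)
  IsNormal N = ∀ g n → Subgroup.mem N n → Subgroup.mem N (g ∙ n ∙ g ⁻¹)

-- Quotient group G/N: same carrier, x ≈ y in G/N iff xN = yN,
-- i.e. x ⁻¹ ∙ y ∈ N.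

module Quotient {c ℓ : Level} (G : Group c ℓ) (N : Subgroup G) (nN : IsNormal G N) where
  open Group G
  open GP G
  open SetoidR setoid
  module N = Subgroup N

  _≈N_ : Carrier → Carrier → Set ℓ
  x ≈N y = N.mem (x ⁻¹ ∙ y)

  ≈⇒≈N : ∀ {x y} → x ≈ y → x ≈N y
  ≈⇒≈N {x} {y} x≈y = N.resp (begin ε ≈⟨ sym (inverseˡ x) ⟩ x ⁻¹ ∙ x ≈⟨ ∙-congˡ x≈y ⟩ x ⁻¹ ∙ y ∎) N.ε-mem

  ≈N-sym : ∀ {x y} → x ≈N y → y ≈N x
  ≈N-sym {x} {y} n = N.resp eq (N.⁻¹-mem n)
    where
    eq : (x ⁻¹ ∙ y) ⁻¹ ≈ y ⁻¹ ∙ x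
    eq = begin (x ⁻¹ ∙ y) ⁻¹ ≈⟨ ⁻¹-anti-homo-∙ (x ⁻¹) y ⟩ y ⁻¹ ∙ x ⁻¹ ⁻¹ ≈⟨ ∙-congˡ (⁻¹-involutive x) ⟩ y ⁻¹ ∙ x ∎

  ≈N-trans : ∀ {x y z} → x ≈N y → y ≈N z → x ≈N z
  ≈N-trans {x} {y} {z} n m = N.resp eq (N.∙-mem n m)
    where
    eq : x ⁻¹ ∙ y ∙ (y ⁻¹ ∙ z) ≈ x ⁻¹ ∙ z
    eq = begin
      x ⁻¹ ∙ y ∙ (y ⁻¹ ∙ z) ≈⟨ assoc (x ⁻¹) y (y ⁻¹ ∙ z) ⟩
      x ⁻¹ ∙ (y ∙ (y ⁻¹ ∙ z)) ≈⟨ ∙-congˡ (sym (assoc y (y ⁻¹) z)) ⟩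
      x ⁻¹ ∙ (y ∙ y ⁻¹ ∙ z) ≈⟨ ∙-congˡ (∙-congʳ (inverseʳ y)) ⟩
      x ⁻¹ ∙ (ε ∙ z) ≈⟨ ∙-congˡ (identityˡ z) ⟩
      x ⁻¹ ∙ z ∎

  ≈N-refl : ∀ {x} → x ≈N x
  ≈N-refl = ≈⇒≈N refl

  ∙-cong-N : ∀ {x x' y y'} → x ≈N x' → y ≈N y' → (x ∙ y) ≈N (x' ∙ y')
  ∙-cong-N {x} {x'} {y} {y'} n m = N.resp eq (N.∙-mem (nN (y ⁻¹) (x ⁻¹ ∙ x') n) m)
    where
    eq : y ⁻¹ ∙ (x ⁻¹ ∙ x') ∙ y ⁻¹ ⁻¹ ∙ (y ⁻¹ ∙ y') ≈ (x ∙ y) ⁻¹ ∙ (x' ∙ y')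
    eq = begin
      y ⁻¹ ∙ (x ⁻¹ ∙ x') ∙ y ⁻¹ ⁻¹ ∙ (y ⁻¹ ∙ y') ≈⟨ assoc _ _ _ ⟩
      y ⁻¹ ∙ (x ⁻¹ ∙ x') ∙ (y ⁻¹ ⁻¹ ∙ (y ⁻¹ ∙ y')) ≈⟨ ∙-congˡ (sym (assoc _ _ _)) ⟩
      y ⁻¹ ∙ (x ⁻¹ ∙ x') ∙ (y ⁻¹ ⁻¹ ∙ y ⁻¹ ∙ y') ≈⟨ ∙-congˡ (∙-congʳ (inverseˡ (y ⁻¹))) ⟩
      y ⁻¹ ∙ (x ⁻¹ ∙ x') ∙ (ε ∙ y') ≈⟨ ∙-congˡ (identityˡ y') ⟩
      y ⁻¹ ∙ (x ⁻¹ ∙ x') ∙ y' ≈⟨ ∙-congʳ (sym (assoc _ _ _)) ⟩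
      y ⁻¹ ∙ x ⁻¹ ∙ x' ∙ y' ≈⟨ assoc _ _ _ ⟩
      y ⁻¹ ∙ x ⁻¹ ∙ (x' ∙ y') ≈⟨ ∙-congʳ (sym (⁻¹-anti-homo-∙ x y)) ⟩
      (x ∙ y) ⁻¹ ∙ (x' ∙ y') ∎

  ⁻¹-cong-N : ∀ {x x'} → x ≈N x' → (x ⁻¹) ≈N (x' ⁻¹)
  ⁻¹-cong-N {x} {x'} n = N.resp eq (nN x _ (N.⁻¹-mem n))
    where
    eq : x ∙ (x ⁻¹ ∙ x') ⁻¹ ∙ x ⁻¹ ≈ x ⁻¹ ⁻¹ ∙ x' ⁻¹
    eq = begin
      x ∙ (x ⁻¹ ∙ x') ⁻¹ ∙ x ⁻¹ ≈⟨ ∙-congʳ (∙-congˡ (⁻¹-anti-homo-∙ (x ⁻¹) x')) ⟩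
      x ∙ (x' ⁻¹ ∙ x ⁻¹ ⁻¹) ∙ x ⁻¹ ≈⟨ ∙-congʳ (∙-congˡ (∙-congˡ (⁻¹-involutive x))) ⟩
      x ∙ (x' ⁻¹ ∙ x) ∙ x ⁻¹ ≈⟨ ∙-congʳ (sym (assoc _ _ _)) ⟩
      x ∙ x' ⁻¹ ∙ x ∙ x ⁻¹ ≈⟨ assoc _ _ _ ⟩
      x ∙ x' ⁻¹ ∙ (x ∙ x ⁻¹) ≈⟨ ∙-congˡ (inverseʳ x) ⟩
      x ∙ x' ⁻¹ ∙ ε ≈⟨ identityʳ _ ⟩
      x ∙ x' ⁻¹ ≈⟨ ∙-congʳ (sym (⁻¹-involutive x)) ⟩
      x ⁻¹ ⁻¹ ∙ x' ⁻¹ ∎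

  quotientGroup : Group c ℓ
  quotientGroup = record
    { Carrier = Carrier
    ; _≈_ = _≈N_
    ; _∙_ = _∙_
    ; ε = ε
    ; _⁻¹ = _⁻¹
    ; isGroup = record
      { isMonoid = record
        { isSemigroup = record
          { isMagma = record
            { isEquivalence = record { refl = ≈N-refl ; sym = ≈N-sym ; trans = ≈N-trans }
            ; ∙-cong = ∙-cong-N }
          ; assoc = λ x y z → ≈⇒≈N (assoc x y z) }
        ; identity = (λ x → ≈⇒≈N (identityˡ x)) , (λ x → ≈⇒≈N (identityʳ x)) }
      ; inverse = (λ x → ≈⇒≈N (inverseˡ x)) , (λ x → ≈⇒≈N (inverseʳ x))
      ; ⁻¹-cong = ⁻¹-cong-N }
    }

  quotientSubgroup : (H : Subgroup G) → (∀ x → N.mem x → Subgroup.mem H x) → Subgroup quotientGroup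
  quotientSubgroup H N⊆H = record
    { subset = record
      { mem = H.mem
      ; resp = λ {x} {y} n hx → H.resp (eq x y) (H.∙-mem hx (N⊆H _ n))
      ; dec = H.dec }
    ; ε-mem = H.ε-mem
    ; ∙-mem = H.∙-mem
    ; ⁻¹-mem = H.⁻¹-mem }
    where
    module H = Subgroup H
    eq : ∀ x y → x ∙ (x ⁻¹ ∙ y) ≈ y
    eq x y = begin
      x ∙ (x ⁻¹ ∙ y) ≈⟨ sym (assoc _ _ _) ⟩
      x ∙ x ⁻¹ ∙ y ≈⟨ ∙-congʳ (inverseʳ x) ⟩
      ε ∙ y ≈⟨ identityˡ y ⟩
      y ∎

_/_∣_ : ∀ {c ℓ} (G : FiniteGroup c ℓ) (N : Subgroup (FiniteGroup.group G)) →
        IsNormal (FiniteGroup.group G) N → FiniteGroup c ℓ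
G / N ∣ nN = record
  { group = Q.quotientGroup
  ; _≟_ = λ x y → Subgroup.dec N (x ⁻¹ ∙ y)
  ; elements = elements
  ; complete = λ x → Any.map Q.≈⇒≈N (complete x) }
  where
  open FiniteGroup G
  module Q = Quotient group N nN

quotientSubgroup : ∀ {c ℓ} (G : FiniteGroup c ℓ) (N : Subgroup (FiniteGroup.group G))
  (nN : IsNormal (FiniteGroup.group G) N) (H : Subgroup (FiniteGroup.group G)) →
  (∀ x → Subgroup.mem N x → Subgroup.mem H x) → Subgroup (FiniteGroup.group (G / N ∣ nN))
quotientSubgroup G N nN = Quotient.quotientSubgroup (FiniteGroup.group G) N nN

module _ {c ℓ : Level} (G : FiniteGroup c ℓ) where
  open FiniteGroup G

  IsConnectionSet : Subset group → Set (c ⊔ ℓ)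
  IsConnectionSet S = (¬ Subset.mem S ε) × (∀ x → Subset.mem S x → Subset.mem S (x ⁻¹))

  Adjacent : Subset group → Carrier → Carrier → Set ℓ
  Adjacent S x y = Subset.mem S (y ∙ x ⁻¹)

  WithinOne : Subset group → Carrier → Carrier → Set ℓ
  WithinOne S x y = x ≈ y ⊎ Adjacent S x y

  IsPerfectCodeIn : Subset group → Subset group → Set (c ⊔ ℓ)
  IsPerfectCodeIn S C = ∀ g →
    (∃ λ x → Subset.mem C x × WithinOne S x g) ×
    (∀ x y → Subset.mem C x → Subset.mem C y → WithinOne S x g → WithinOne S y g → x ≈ y)

  IsPerfectCodeOf : Subgroup group → Set (c ⊔ lsuc ℓ)
  IsPerfectCodeOf H = ∃ λ (S : Subset group) → IsConnectionSet S × IsPerfectCodeIn S (Subgroup.subset H)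

{-# OPTIONS --safe #-}
-- A subgroup H is a perfect code of G exactly when it has an inverse-closed
-- left transversal T containing 1: given a connection set S, take T = S ∪ {1};
-- conversely take S = T ∖ {1}. Such transversals pass to and from quotients.
-- (a) If T is one for H in G, then TN/N is one for H/N in G/N.
-- (b) If T_N is one for N in G and T' (a union of N-cosets) is one for H/N,
-- then T_N ∩ T' is one for H in G: write g = t' h with h ∈ H, t' ∈ T', then
-- t' = t n with t ∈ T_N, n ∈ N, so g = t (n h) and t ∈ t' N ⊆ T'.
module Submission where

open import Defs
open import Level using (Level; _⊔_) renaming (suc to lsuc)
open import Algebra.Bundles using (Group)
import Algebra.Properties.Group as GroupProperties
open import Data.Product using (_×_; _,_; proj₁; proj₂; ∃)
open import Data.Sum using (_⊎_; inj₁; inj₂)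
open import Relation.Nullary using (¬_; yes; no)
open import Relation.Nullary.Decidable using (_×-dec_; _⊎-dec_; ¬?)
import Relation.Binary.Reasoning.Setoid as SetoidReasoning

module GroupIdentities {c ℓ : Level} (G : Group c ℓ) where
  open Group G
  open GroupProperties G
  open SetoidReasoning setoid

  x≈x∙ε⁻¹ : ∀ x → x ≈ x ∙ ε ⁻¹
  x≈x∙ε⁻¹ x = begin
    x        ≈⟨ identityʳ x ⟨
    x ∙ ε    ≈⟨ ∙-congˡ ε⁻¹≈ε ⟨
    x ∙ ε ⁻¹ ∎

  x∙y⁻¹∙z⁻¹≈x∙[z∙y]⁻¹ : ∀ x y z → x ∙ y ⁻¹ ∙ z ⁻¹ ≈ x ∙ (z ∙ y) ⁻¹
  x∙y⁻¹∙z⁻¹≈x∙[z∙y]⁻¹ x y z = begin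
    x ∙ y ⁻¹ ∙ z ⁻¹   ≈⟨ assoc x (y ⁻¹) (z ⁻¹) ⟩
    x ∙ (y ⁻¹ ∙ z ⁻¹) ≈⟨ ∙-congˡ (⁻¹-anti-homo-∙ z y) ⟨
    x ∙ (z ∙ y) ⁻¹    ∎

  x∙y⁻¹∙[z∙y⁻¹]⁻¹≈x∙z⁻¹ : ∀ x y z → x ∙ y ⁻¹ ∙ (z ∙ y ⁻¹) ⁻¹ ≈ x ∙ z ⁻¹
  x∙y⁻¹∙[z∙y⁻¹]⁻¹≈x∙z⁻¹ x y z = begin
    x ∙ y ⁻¹ ∙ (z ∙ y ⁻¹) ⁻¹ ≈⟨ x∙y⁻¹∙z⁻¹≈x∙[z∙y]⁻¹ x y (z ∙ y ⁻¹) ⟩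
    x ∙ (z ∙ y ⁻¹ ∙ y) ⁻¹    ≈⟨ ∙-congˡ (⁻¹-cong (//-rightDividesˡ y z)) ⟩
    x ∙ z ⁻¹                 ∎

  y∙[x⁻¹∙y]⁻¹≈x : ∀ x y → y ∙ (x ⁻¹ ∙ y) ⁻¹ ≈ x
  y∙[x⁻¹∙y]⁻¹≈x x y = begin
    y ∙ (x ⁻¹ ∙ y) ⁻¹    ≈⟨ ∙-congˡ (⁻¹-anti-homo-∙ (x ⁻¹) y) ⟩
    y ∙ (y ⁻¹ ∙ x ⁻¹ ⁻¹) ≈⟨ \\-leftDividesˡ y (x ⁻¹ ⁻¹) ⟩
    x ⁻¹ ⁻¹              ≈⟨ ⁻¹-involutive x ⟩
    x                    ∎

  x⁻¹∙[y∙x⁻¹]⁻¹≈y⁻¹ : ∀ x y → x ⁻¹ ∙ (y ∙ x ⁻¹) ⁻¹ ≈ y ⁻¹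
  x⁻¹∙[y∙x⁻¹]⁻¹≈y⁻¹ x y = begin
    x ⁻¹ ∙ (y ∙ x ⁻¹) ⁻¹         ≈⟨ ∙-congˡ (⁻¹-anti-homo-∙ y (x ⁻¹)) ⟩
    x ⁻¹ ∙ (x ⁻¹ ⁻¹ ∙ y ⁻¹)      ≈⟨ \\-leftDividesˡ (x ⁻¹) (y ⁻¹) ⟩
    y ⁻¹                         ∎

  x∙y≈z∙w⇒w∙y⁻¹≈z⁻¹∙x : ∀ {x y z w} → x ∙ y ≈ z ∙ w → w ∙ y ⁻¹ ≈ z ⁻¹ ∙ x
  x∙y≈z∙w⇒w∙y⁻¹≈z⁻¹∙x {x} {y} {z} {w} e = sym (x≈z//y (z ⁻¹ ∙ x) y w (begin
    z ⁻¹ ∙ x ∙ y   ≈⟨ assoc (z ⁻¹) x y ⟩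
    z ⁻¹ ∙ (x ∙ y) ≈⟨ ∙-congˡ e ⟩
    z ⁻¹ ∙ (z ∙ w) ≈⟨ \\-leftDividesʳ z w ⟩
    w              ∎))

module NormalSubgroup {c ℓ : Level} (G : Group c ℓ) (N : Subgroup G) (normal : IsNormal G N) where
  open Group G
  open GroupProperties G
  open Subgroup N

  ⁻¹∙∈⇒∙⁻¹∈ : ∀ {x y} → mem (x ⁻¹ ∙ y) → mem (y ∙ x ⁻¹)
  ⁻¹∙∈⇒∙⁻¹∈ {x} {y} n = resp (∙-congʳ (\\-leftDividesˡ x y)) (normal x (x ⁻¹ ∙ y) n)

  ∙⁻¹∈⇒⁻¹∙∈ : ∀ {x y} → mem (y ∙ x ⁻¹) → mem (x ⁻¹ ∙ y)
  ∙⁻¹∈⇒⁻¹∙∈ {x} {y} n =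
    resp (trans (assoc (x ⁻¹) (y ∙ x ⁻¹) (x ⁻¹ ⁻¹)) (∙-congˡ (//-rightDividesʳ (x ⁻¹) y)))
         (normal (x ⁻¹) (y ∙ x ⁻¹) n)

module _ {c ℓ : Level} (G : Group c ℓ) where
  open Group G

  record InverseClosedLeftTransversal (H : Subgroup G) : Set (c ⊔ lsuc ℓ) where
    field
      transversal   : Subset G
      ε∈            : Subset.mem transversal ε
      ⁻¹-closed     : ∀ {x} → Subset.mem transversal x → Subset.mem transversal (x ⁻¹)
      factor        : ∀ g → ∃ λ h → Subgroup.mem H h × Subset.mem transversal (g ∙ h ⁻¹)
      factor-unique : ∀ {g h h′} → Subgroup.mem H h → Subgroup.mem H h′ →
                      Subset.mem transversal (g ∙ h ⁻¹) → Subset.mem transversal (g ∙ h′ ⁻¹) → h ≈ h′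

module _ {c ℓ : Level} (G : FiniteGroup c ℓ) (H : Subgroup (FiniteGroup.group G)) where
  open FiniteGroup G
  open GroupProperties group
  private module H = Subgroup H

  perfectCode⇒transversal : IsPerfectCodeOf G H → InverseClosedLeftTransversal group H
  perfectCode⇒transversal (S , (_ , S-⁻¹-closed) , perfect) = record
    { transversal   = S∪ε
    ; ε∈            = inj₁ refl
    ; ⁻¹-closed     = ⁻¹-closed
    ; factor        = factor
    ; factor-unique = λ {g} h∈H h′∈H t t′ →
        proj₂ (perfect g) _ _ h∈H h′∈H (∈S∪ε⇒withinOne t) (∈S∪ε⇒withinOne t′)
    }
    where
    module S = Subset S

    S∪ε : Subset group
    S∪ε = record
      { mem  = λ x → x ≈ ε ⊎ S.mem x
      ; resp = λ { e (inj₁ x≈ε) → inj₁ (trans (sym e) x≈ε) ; e (inj₂ s) → inj₂ (S.resp e s) }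
      ; dec  = λ x → (x ≟ ε) ⊎-dec S.dec x
      }

    ⁻¹-closed : ∀ {x} → Subset.mem S∪ε x → Subset.mem S∪ε (x ⁻¹)
    ⁻¹-closed (inj₁ x≈ε) = inj₁ (trans (⁻¹-cong x≈ε) ε⁻¹≈ε)
    ⁻¹-closed (inj₂ s)   = inj₂ (S-⁻¹-closed _ s)

    ∈S∪ε⇒withinOne : ∀ {g h} → Subset.mem S∪ε (g ∙ h ⁻¹) → WithinOne G S h g
    ∈S∪ε⇒withinOne {g} {h} (inj₁ e) = inj₁ (sym (x∙y⁻¹≈ε⇒x≈y g h e))
    ∈S∪ε⇒withinOne (inj₂ s)         = inj₂ s

    factor : ∀ g → ∃ λ h → H.mem h × Subset.mem S∪ε (g ∙ h ⁻¹)
    factor g with proj₁ (perfect g)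
    ... | h , h∈H , inj₁ h≈g = h , h∈H , inj₁ (x≈y⇒x∙y⁻¹≈ε (sym h≈g))
    ... | h , h∈H , inj₂ s   = h , h∈H , inj₂ s

  transversal⇒perfectCode : InverseClosedLeftTransversal group H → IsPerfectCodeOf G H
  transversal⇒perfectCode τ = T∖ε , ((λ (_ , ε≉ε) → ε≉ε refl) , T∖ε-⁻¹-closed) , perfect
    where
    open InverseClosedLeftTransversal τ
    module T = Subset transversal

    T∖ε : Subset group
    T∖ε = record
      { mem  = λ x → T.mem x × ¬ x ≈ ε
      ; resp = λ e (t , x≉ε) → T.resp e t , λ y≈ε → x≉ε (trans e y≈ε)
      ; dec  = λ x → T.dec x ×-dec ¬? (x ≟ ε)
      }

    T∖ε-⁻¹-closed : ∀ x → Subset.mem T∖ε x → Subset.mem T∖ε (x ⁻¹)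
    T∖ε-⁻¹-closed x (t , x≉ε) =
      ⁻¹-closed t , λ x⁻¹≈ε → x≉ε (trans (sym (⁻¹-involutive x)) (trans (⁻¹-cong x⁻¹≈ε) ε⁻¹≈ε))

    withinOne⇒∈T : ∀ {g h} → WithinOne G T∖ε h g → T.mem (g ∙ h ⁻¹)
    withinOne⇒∈T (inj₁ h≈g)     = T.resp (sym (x≈y⇒x∙y⁻¹≈ε (sym h≈g))) ε∈
    withinOne⇒∈T (inj₂ (t , _)) = t

    perfect : IsPerfectCodeIn G T∖ε (Subgroup.subset H)
    perfect g = nearest (factor g) , λ _ _ h∈H h′∈H w w′ →
      factor-unique h∈H h′∈H (withinOne⇒∈T w) (withinOne⇒∈T w′)
      where
      nearest : (∃ λ h → H.mem h × T.mem (g ∙ h ⁻¹)) → ∃ λ h → H.mem h × WithinOne G T∖ε h g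
      nearest (h , h∈H , t) with (g ∙ h ⁻¹) ≟ ε
      ... | yes e   = h , h∈H , inj₁ (sym (x∙y⁻¹≈ε⇒x≈y g h e))
      ... | no g≉h  = h , h∈H , inj₂ (t , g≉h)

module QuotientTransversal {c ℓ : Level} (G : Group c ℓ) (N : Subgroup G) (normal : IsNormal G N)
    (H : Subgroup G) (N⊆H : ∀ x → Subgroup.mem N x → Subgroup.mem H x) where
  open Group G
  open GroupProperties G
  open GroupIdentities G
  open NormalSubgroup G N normal
  module N = Subgroup N
  module H = Subgroup H
  module Q = Quotient G N normal
  open Q using (quotientGroup; _≈N_)

  H/N : Subgroup quotientGroup
  H/N = Q.quotientSubgroup H N⊆H

  ≈N-∙ʳ : ∀ {x n} → N.mem n → x ≈N (x ∙ n)
  ≈N-∙ʳ {x} {n} n∈N = N.resp (sym (\\-leftDividesʳ x n)) n∈N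

  transversal-quotient : InverseClosedLeftTransversal G H → InverseClosedLeftTransversal quotientGroup H/N
  transversal-quotient τ = record
    { transversal   = TN
    ; ε∈            = T⊆TN ε∈
    ; ⁻¹-closed     = TN-⁻¹-closed
    ; factor        = λ g → let h , h∈H , t = factor g in h , h∈H , T⊆TN t
    ; factor-unique = TN-factor-unique
    }
    where
    open InverseClosedLeftTransversal τ
    module T = Subset transversal

    H-factor : Carrier → Carrier
    H-factor x = proj₁ (factor x)

    ∙H-factor⁻¹∈T : ∀ x → T.mem (x ∙ H-factor x ⁻¹)
    ∙H-factor⁻¹∈T x = proj₂ (proj₂ (factor x))

    -- By uniqueness of the factorisation, x ∈ T N iff the H-factor of x lies in N;
    -- the latter is what makes membership in T N decidable.
    H-factor∈N : ∀ {x n} → N.mem n → T.mem (x ∙ n ⁻¹) → N.mem (H-factor x)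
    H-factor∈N {x} n∈N t =
      N.resp (sym (factor-unique (proj₁ (proj₂ (factor x))) (N⊆H _ n∈N) (∙H-factor⁻¹∈T x) t)) n∈N

    TN : Subset quotientGroup
    TN = record
      { mem  = λ x → N.mem (H-factor x)
      ; resp = λ {x} {y} x≈Ny n∈N → H-factor∈N (N.∙-mem n∈N x≈Ny)
          (T.resp (trans (∙-congʳ (sym (y∙[x⁻¹∙y]⁻¹≈x x y))) (x∙y⁻¹∙z⁻¹≈x∙[z∙y]⁻¹ y _ _))
                  (∙H-factor⁻¹∈T x))
      ; dec  = λ x → N.dec (H-factor x)
      }

    T⊆TN : ∀ {x} → T.mem x → Subset.mem TN x
    T⊆TN t = H-factor∈N N.ε-mem (T.resp (x≈x∙ε⁻¹ _) t)

    TN-⁻¹-closed : ∀ {x} → Subset.mem TN x → Subset.mem TN (x ⁻¹)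
    TN-⁻¹-closed {x} n∈N = H-factor∈N (normal x _ (N.⁻¹-mem n∈N))
      (T.resp (sym (x⁻¹∙[y∙x⁻¹]⁻¹≈y⁻¹ x _)) (⁻¹-closed (∙H-factor⁻¹∈T x)))

    TN-factor-unique : ∀ {g h h′} → H.mem h → H.mem h′ →
      Subset.mem TN (g ∙ h ⁻¹) → Subset.mem TN (g ∙ h′ ⁻¹) → h ≈N h′
    TN-factor-unique {g} {h} {h′} h∈H h′∈H n∈N n′∈N =
      ∙⁻¹∈⇒⁻¹∙∈ (N.resp (sym (x∙y≈z∙w⇒w∙y⁻¹≈z⁻¹∙x nh≈n′h′)) (N.∙-mem (N.⁻¹-mem n′∈N) n∈N))
      where
      nh≈n′h′ : H-factor (g ∙ h ⁻¹) ∙ h ≈ H-factor (g ∙ h′ ⁻¹) ∙ h′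
      nh≈n′h′ = factor-unique (H.∙-mem (N⊆H _ n∈N) h∈H) (H.∙-mem (N⊆H _ n′∈N) h′∈H)
        (T.resp (x∙y⁻¹∙z⁻¹≈x∙[z∙y]⁻¹ g h _) (∙H-factor⁻¹∈T _))
        (T.resp (x∙y⁻¹∙z⁻¹≈x∙[z∙y]⁻¹ g h′ _) (∙H-factor⁻¹∈T _))

  transversal-lift : InverseClosedLeftTransversal G N → InverseClosedLeftTransversal quotientGroup H/N →
                     InverseClosedLeftTransversal G H
  transversal-lift τᴺ τ′ = record
    { transversal   = Tᴺ∩T′
    ; ε∈            = Tᴺ.ε∈ , T′.ε∈
    ; ⁻¹-closed     = λ (t , t′) → Tᴺ.⁻¹-closed t , T′.⁻¹-closed t′
    ; factor        = factor
    ; factor-unique = factor-unique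
    }
    where
    module Tᴺ = InverseClosedLeftTransversal τᴺ
    module T′ = InverseClosedLeftTransversal τ′
    module Tᴺs = Subset Tᴺ.transversal
    module T′s = Subset T′.transversal

    Tᴺ∩T′ : Subset G
    Tᴺ∩T′ = record
      { mem  = λ x → Tᴺs.mem x × T′s.mem x
      ; resp = λ e (t , t′) → Tᴺs.resp e t , T′s.resp (Q.≈⇒≈N e) t′
      ; dec  = λ x → Tᴺs.dec x ×-dec T′s.dec x
      }

    factor : ∀ g → ∃ λ h → H.mem h × Subset.mem Tᴺ∩T′ (g ∙ h ⁻¹)
    factor g with T′.factor g
    ... | h , h∈H , t′ with Tᴺ.factor (g ∙ h ⁻¹)
    ... | n , n∈N , t =
      n ∙ h , H.∙-mem (N⊆H n n∈N) h∈H , Tᴺs.resp gh⁻¹n⁻¹≈g[nh]⁻¹ t ,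
      T′s.resp (Q.≈N-trans (≈N-∙ʳ (N.⁻¹-mem n∈N)) (Q.≈⇒≈N gh⁻¹n⁻¹≈g[nh]⁻¹)) t′
      where
      gh⁻¹n⁻¹≈g[nh]⁻¹ : g ∙ h ⁻¹ ∙ n ⁻¹ ≈ g ∙ (n ∙ h) ⁻¹
      gh⁻¹n⁻¹≈g[nh]⁻¹ = x∙y⁻¹∙z⁻¹≈x∙[z∙y]⁻¹ g h n

    -- Uniqueness in G/N puts h′ h⁻¹ in N; uniqueness for N then forces h′ h⁻¹ ≈ ε.
    factor-unique : ∀ {g h h′} → H.mem h → H.mem h′ →
      Subset.mem Tᴺ∩T′ (g ∙ h ⁻¹) → Subset.mem Tᴺ∩T′ (g ∙ h′ ⁻¹) → h ≈ h′
    factor-unique {g} {h} {h′} h∈H h′∈H (t , t′) (u , u′) =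
      sym (x∙y⁻¹≈ε⇒x≈y h′ h (sym (Tᴺ.factor-unique N.ε-mem h′h⁻¹∈N
        (Tᴺs.resp (x≈x∙ε⁻¹ _) t) (Tᴺs.resp (sym (x∙y⁻¹∙[z∙y⁻¹]⁻¹≈x∙z⁻¹ g h h′)) u))))
      where
      h′h⁻¹∈N : N.mem (h′ ∙ h ⁻¹)
      h′h⁻¹∈N = ⁻¹∙∈⇒∙⁻¹∈ (T′.factor-unique h∈H h′∈H t′ u′)

theorem3p7 : ∀ {c ℓ} (G : FiniteGroup c ℓ) (N : Subgroup (FiniteGroup.group G))
    (nN : IsNormal (FiniteGroup.group G) N) (H : Subgroup (FiniteGroup.group G))
    (N⊆H : ∀ x → Subgroup.mem N x → Subgroup.mem H x) →
    (IsPerfectCodeOf G H → IsPerfectCodeOf (G / N ∣ nN) (quotientSubgroup G N nN H N⊆H))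
    × (IsPerfectCodeOf G N → IsPerfectCodeOf (G / N ∣ nN) (quotientSubgroup G N nN H N⊆H) → IsPerfectCodeOf G H)
theorem3p7 {c} {ℓ} G N nN H N⊆H =
    (λ codeH → transversal⇒perfectCode G/N H/N
                 (transversal-quotient (perfectCode⇒transversal G H codeH)))
  , (λ codeN codeH/N → transversal⇒perfectCode G H
                         (transversal-lift (perfectCode⇒transversal G N codeN)
                                           (perfectCode⇒transversal G/N H/N codeH/N)))
  where
  open QuotientTransversal (FiniteGroup.group G) N nN H N⊆H
  G/N : FiniteGroup c ℓ
  G/N = G / N ∣ nN
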